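{- Let $\Delta$ and $\Sigma$ be finite alphabets, $w\in\Delta^*$, $\psi:\Delta^*\to\Delta^*$ a non-erasing morphism of free monoids, and $\tau:\Delta\to\Sigma$ a map (extended letter-wise to strings). Then there is a constant $C$ such that $\ell(\tau(\psi^d(w)))\le C$ for every $d>0$; that is, $\ell=O(1)$ on the family $\{\tau(\psi^d(w)) : d>0\}$.
   Context: A morphism $\psi:\Delta^*\to\Delta^*$ satisfies $\psi(xy)=\psi(x)\psi(y)$ and is determined by its values on letters; it is non-erasing if $|\psi(a)|>0$ for every $a\in\Delta$. $\psi^d$ denotes the $d$-fold composition. L-system: a tuple $L=(V,R,S,\tau,d,n)$ where $V$ is a finite set of variables, $R: V\to V^+$ assigns to each variable a nonempty string (extended homomorphically to strings), $S\in V^*$ is the axiom, $\tau: V\to V$ is a coding (letter-to-letter map, extended homomorphically), $d\in\mathbb{N}$ and $n\in\mathbb{N}$. Its levels are $L_0=S$ and $L_{i+1}=R(L_i)$; it generates the string $w[1,n]=\tau(L_d[1,n])$. Its size is $|S|+\sum_{A\in V}|R(A)|$. $\ell(x)$ is the size of the smallest L-system generating a string $x$. -}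

module Defs where

open import Data.Nat using (ℕ; zero; suc; _+_; _≤_; _<_)
open import Data.Fin using (Fin)
open import Data.List using (List; []; _∷_; length; concatMap; map; take; allFin)
open import Data.Nat.ListAction using (sum)
open import Data.List.NonEmpty using (List⁺; toList)
open import Relation.Binary.PropositionalEquality using (_≡_)

-- Strings over an alphabet A are lists.
-- A morphism ψ : Δ* → Δ* is determined by its values on letters;
-- its homomorphic extension to strings:
extend : {A B : Set} → (A → List B) → List A → List B
extend f = concatMap f

iter : {A : Set} → (A → List A) → ℕ → List A → List A
iter ψ zero    x = x
iter ψ (suc d) x = extend ψ (iter ψ d x)

NonErasing : {A : Set} → (A → List A) → Set
NonErasing {A} ψ = (a : A) → 1 ≤ length (ψ a)

-- L-system L = (V, R, S, τ, d, n) with variable set V = Fin k and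
-- output alphabet B.
record LSystem (B : Set) : Set where
  field
    k : ℕ
    R : Fin k → List⁺ (Fin k)
    S : List (Fin k)
    τ : Fin k → B
    d : ℕ
    n : ℕ

module _ {B : Set} (L : LSystem B) where
  open LSystem L

  level : ℕ → List (Fin k)
  level i = iter (λ a → toList (R a)) i S

  size : ℕ
  size = length S + sum (map (λ a → length (toList (R a))) (allFin k))

  Generates : List B → Set
  Generates x = (n ≤ length (level d)) Data.Product.× (x ≡ map τ (take n (level d)))
    where import Data.Product

-- ℓ(x) ≤ c : some L-system of size at most c generates x
-- (ℓ(x) is the minimum size of an L-system generating x).
ℓ≤ : {B : Set} → List B → ℕ → Set
ℓ≤ {B} x c = Data.Product.Σ (LSystem B) (λ L → size L ≤ c Data.Product.× Generates L x)
  where import Data.Product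

module Submission where

open import Defs
open import Data.Nat using (ℕ; zero; suc; _<_; _≤_)
open import Data.Nat.Properties using (≤-refl)
open import Data.Fin using (Fin)
open import Data.List using (List; _∷_; map; length)
open import Data.List.Properties using (concatMap-cong; take-all)
open import Data.List.NonEmpty using (List⁺; toList; _∷_)
open import Data.Product using (∃; _,_)
open import Relation.Binary.PropositionalEquality using (_≡_; refl; cong; sym)

-- The L-system with rules ψ, axiom w and coding τ, run for d steps and cut off at the
-- full length of level d, generates τ(ψ^d(w)). Only its parameters d and n depend on d,
-- and they do not count towards the size, which is therefore the same for every d.

toList⁺ : {A : Set} (xs : List A) → 1 ≤ length xs → List⁺ A
toList⁺ (x ∷ xs) _ = x ∷ xs

toList-toList⁺ : {A : Set} (xs : List A) (p : 1 ≤ length xs) → toList (toList⁺ xs p) ≡ xs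
toList-toList⁺ (x ∷ xs) _ = refl

iter-cong : {A : Set} {f g : A → List A} → (∀ a → f a ≡ g a) → ∀ d x → iter f d x ≡ iter g d x
iter-cong f≗g zero    x = refl
iter-cong {g = g} f≗g (suc d) x rewrite iter-cong f≗g d x = concatMap-cong f≗g (iter g d x)

module _ {m : ℕ} {B : Set} (w : List (Fin m)) (ψ : Fin m → List (Fin m))
         (ne : NonErasing ψ) (τ : Fin m → B) where

  morphicLSystem : ℕ → LSystem B
  morphicLSystem d = record
    { k = m
    ; R = λ a → toList⁺ (ψ a) (ne a)
    ; S = w
    ; τ = τ
    ; d = d
    ; n = length (iter ψ d w)
    }

  level-morphicLSystem : ∀ d → level (morphicLSystem d) d ≡ iter ψ d w
  level-morphicLSystem d = iter-cong (λ a → toList-toList⁺ (ψ a) (ne a)) d w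

  morphicLSystem-generates : ∀ d → Generates (morphicLSystem d) (map τ (iter ψ d w))
  morphicLSystem-generates d rewrite level-morphicLSystem d =
    ≤-refl , cong (map τ) (sym (take-all _ (iter ψ d w) ≤-refl))

theorem7 : (m s : ℕ) (w : List (Fin m)) (ψ : Fin m → List (Fin m)) (τ : Fin m → Fin s) →
    NonErasing ψ →
    ∃ λ (C : ℕ) → (d : ℕ) → 0 < d → ℓ≤ (map τ (iter ψ d w)) C
theorem7 m s w ψ τ ne = size (L 0) , λ d _ → L d , ≤-refl , morphicLSystem-generates w ψ ne τ d
  where
  L : ℕ → LSystem (Fin s)
  L = morphicLSystem w ψ ne τ
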